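{- Let $sexy(n)$ denote the number of $n$-totative numbers $t$ such that $t+6$ is also $n$-totative. Then $sexy(1)=sexy(2)=0$, $sexy(3)=5$, $sexy(4)=30$, and $sexy(n)=(p_n-2)\,sexy(n-1)$ for all $n>4$.
   Context: $p_i$ denotes the $i$th prime. The primorial is $\#(m)=\prod_{i=1}^{m}p_i$. The $m$-primorial set is $\{2,\ldots,\#(m)+1\}$, and an $m$-totative number is an element of it coprime to $\#(m)$. -}

module Defs where

open import Data.Nat using (ℕ; zero; suc; _+_; _*_; _≤_; _≤?_; _!)

open import Data.Nat.Primality using (Prime; prime?)
open import Data.Nat.Coprimality using (Coprime; coprime?)
open import Data.List using (List; []; _∷_; map; filter; length; applyUpTo)
open import Data.Nat.ListAction using (product)
open import Data.Product using (_×_)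
open import Relation.Nullary.Decidable using (_×-dec_)
import Relation.Nullary

range : ℕ → ℕ → List ℕ
range a b = applyUpTo (λ i → a + i) (suc b Data.Nat.∸ a)

headOr0 : List ℕ → ℕ
headOr0 []      = 0
headOr0 (x ∷ _) = x

-- the least prime strictly greater than p; by Euclid it lies in (p, p! + 1]
nextPrime : ℕ → ℕ
nextPrime p = headOr0 (filter prime? (range (suc p) (p ! + 1)))

-- p i = the i-th prime, 1-indexed: p 1 = 2, p 2 = 3, ...  (p 0 is an unused dummy value)
p : ℕ → ℕ
p zero          = 1
p (suc zero)    = 2
p (suc (suc i)) = nextPrime (p (suc i))

primorial : ℕ → ℕ
primorial m = product (map p (range 1 m))

Totative : ℕ → ℕ → Set
Totative m t = (2 ≤ t × t ≤ primorial m + 1) × Coprime t (primorial m)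

totative? : ∀ m t → Relation.Nullary.Dec (Totative m t)
totative? m t = ((2 ≤? t) ×-dec (t ≤? primorial m + 1)) ×-dec coprime? t (primorial m)

sexy : ℕ → ℕ
sexy m = length (filter (λ t → totative? m t ×-dec totative? m (t + 6)) (range 2 (primorial m + 1)))

-- Write #(n) = q·#(n−1) with q = p_n.  A residue t mod #(n) is a pair (a, b) with
-- t = b·#(n−1) + a, a < #(n−1), b < q; t and t+6 are coprime to #(n) iff a and a+6
-- are coprime to #(n−1) and q divides neither t nor t+6.  As #(n−1) is invertible
-- mod q, for fixed a each of the two divisibilities holds for exactly one b < q, and
-- for q > 6 these two values of b differ, so q − 2 values of b survive.  For n ≥ 4
-- the window {2, …, #(n)+1} is a full period, and the condition t + 6 ≤ #(n)+1 in the
-- definition of totatives is automatic because 210 ∣ #(n).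
module Submission where

open import Data.Empty using (⊥-elim)
open import Data.List using (List; []; _∷_; [_]; _++_; map; filter; length; applyUpTo; _∷ʳ_)
open import Data.List.Properties using (applyUpTo-∷ʳ; map-++)
open import Data.List.Membership.Propositional using (_∈_)
open import Data.List.Membership.Propositional.Properties using (∈-applyUpTo⁺; ∈-filter⁺)
open import Data.List.Relation.Unary.All using (All; []; _∷_)
import Data.List.Relation.Unary.All.Properties as All
open import Data.Nat
open import Data.Nat.Coprimality using (Coprime; coprime?; coprime-divisor; coprime-Bézout; prime⇒coprime)
open import Data.Nat.Divisibility
open import Data.Nat.DivMod using (_%_; _/_; m≡m%n+[m/n]*n; m%n<n)
open import Data.Nat.GCD using (module Bézout)
open import Data.Nat.ListAction using (sum; product)
open import Data.Nat.ListAction.Properties using (product-++)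
open import Data.Nat.Primality
open import Data.Nat.Primality.Factorisation using (factorise)
open import Data.Nat.Properties
open import Algebra.Properties.CommutativeSemigroup +-commutativeSemigroup using (interchange; xy∙z≈xz∙y)
open import Data.Nat.Solver using (module +-*-Solver)
open import Data.Product using (_×_; _,_; proj₁; proj₂; ∃-syntax)
open import Data.Sum using (inj₁; inj₂)
open import Function using (_∘_; case_of_; _⇔_; mk⇔; Equivalence)
open import Function.Properties.Equivalence using () renaming (trans to ⇔-trans)
open import Data.Product.Function.NonDependent.Propositional using (_×-⇔_)
open import Relation.Binary.Definitions using (tri<; tri≈; tri>)
open import Relation.Binary.PropositionalEquality using (_≡_; _≢_; refl; sym; trans; cong; cong₂; subst; module ≡-Reasoning)
open import Relation.Nullary using (Dec; yes; no; ¬_; contradiction)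
open import Relation.Nullary.Decidable using (_×-dec_; ¬?)
open import Defs

open +-*-Solver using (solve; _:+_; _:*_; _:=_; con)
open Equivalence using (to; from)

private
  variable
    a b c k m n x t : ℕ

sumUpTo : (ℕ → ℕ) → ℕ → ℕ
sumUpTo f n = sum (applyUpTo f n)

sumUpTo-cong : ∀ {f g} n → (∀ i → i < n → f i ≡ g i) → sumUpTo f n ≡ sumUpTo g n
sumUpTo-cong zero    _   = refl
sumUpTo-cong (suc n) f≡g = cong₂ _+_ (f≡g 0 z<s) (sumUpTo-cong n (λ i i<n → f≡g (suc i) (s<s i<n)))

sumUpTo-zero : ∀ {f} n → (∀ i → i < n → f i ≡ 0) → sumUpTo f n ≡ 0
sumUpTo-zero zero    _   = refl
sumUpTo-zero (suc n) f≡0 = cong₂ _+_ (f≡0 0 z<s) (sumUpTo-zero n (λ i i<n → f≡0 (suc i) (s<s i<n)))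

sumUpTo-const : ∀ c n → sumUpTo (λ _ → c) n ≡ n * c
sumUpTo-const c zero    = refl
sumUpTo-const c (suc n) = cong (c +_) (sumUpTo-const c n)

sumUpTo-+ : ∀ f m n → sumUpTo f (m + n) ≡ sumUpTo f m + sumUpTo (λ i → f (m + i)) n
sumUpTo-+ f zero    n = refl
sumUpTo-+ f (suc m) n = trans (cong (f 0 +_) (sumUpTo-+ (f ∘ suc) m n)) (sym (+-assoc (f 0) _ _))

sumUpTo-suc : ∀ f n → sumUpTo f (suc n) ≡ sumUpTo f n + f n
sumUpTo-suc f zero    = +-comm (f 0) 0
sumUpTo-suc f (suc n) = trans (cong (f 0 +_) (sumUpTo-suc (f ∘ suc) n)) (sym (+-assoc (f 0) _ _))

sumUpTo-distrib-+ : ∀ f g n → sumUpTo (λ i → f i + g i) n ≡ sumUpTo f n + sumUpTo g n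
sumUpTo-distrib-+ f g zero    = refl
sumUpTo-distrib-+ f g (suc n) =
  trans (cong (f 0 + g 0 +_) (sumUpTo-distrib-+ (f ∘ suc) (g ∘ suc) n)) (interchange (f 0) (g 0) _ _)

sumUpTo-*ˡ : ∀ c f n → sumUpTo (λ i → c * f i) n ≡ c * sumUpTo f n
sumUpTo-*ˡ c f zero    = sym (*-zeroʳ c)
sumUpTo-*ˡ c f (suc n) = trans (cong (c * f 0 +_) (sumUpTo-*ˡ c (f ∘ suc) n)) (sym (*-distribˡ-+ c (f 0) _))

sumUpTo-comm : ∀ (f : ℕ → ℕ → ℕ) m n →
               sumUpTo (λ i → sumUpTo (f i) n) m ≡ sumUpTo (λ j → sumUpTo (λ i → f i j) m) n
sumUpTo-comm f zero    n = sym (sumUpTo-zero n (λ _ _ → refl))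
sumUpTo-comm f (suc m) n =
  trans (cong (sumUpTo (f 0) n +_) (sumUpTo-comm (f ∘ suc) m n))
        (sym (sumUpTo-distrib-+ (f 0) (λ j → sumUpTo (λ i → f (suc i) j) m) n))

sumUpTo-blocks : ∀ g P q → sumUpTo g (q * P) ≡ sumUpTo (λ b → sumUpTo (λ a → g (b * P + a)) P) q
sumUpTo-blocks g P zero    = refl
sumUpTo-blocks g P (suc q) = begin
  sumUpTo g (P + q * P)
    ≡⟨ sumUpTo-+ g P (q * P) ⟩
  sumUpTo g P + sumUpTo (λ i → g (P + i)) (q * P)
    ≡⟨ cong (sumUpTo g P +_) (sumUpTo-blocks (λ i → g (P + i)) P q) ⟩
  sumUpTo g P + sumUpTo (λ b → sumUpTo (λ a → g (P + (b * P + a))) P) q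
    ≡⟨ cong (sumUpTo g P +_) (sumUpTo-cong q (λ b _ → sumUpTo-cong P (λ a _ →
         cong g (sym (+-assoc P (b * P) a))))) ⟩
  sumUpTo g P + sumUpTo (λ b → sumUpTo (λ a → g (suc b * P + a)) P) q ∎
  where open ≡-Reasoning

sumUpTo-rotate : ∀ h n → h n ≡ h 0 → sumUpTo (h ∘ suc) n ≡ sumUpTo h n
sumUpTo-rotate h n hn≡h0 = +-cancelʳ-≡ (h 0) _ _ (begin
  sumUpTo (h ∘ suc) n + h 0 ≡⟨ +-comm _ (h 0) ⟩
  sumUpTo h (suc n)         ≡⟨ sumUpTo-suc h n ⟩
  sumUpTo h n + h n         ≡⟨ cong (sumUpTo h n +_) hn≡h0 ⟩
  sumUpTo h n + h 0         ∎)
  where open ≡-Reasoning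

sumUpTo-periodic : ∀ h n → (∀ x → h (x + n) ≡ h x) → ∀ c → sumUpTo (λ i → h (c + i)) n ≡ sumUpTo h n
sumUpTo-periodic h n per zero    = refl
sumUpTo-periodic h n per (suc c) =
  trans (sumUpTo-periodic (h ∘ suc) n (per ∘ suc) c) (sumUpTo-rotate h n (per 0))

sumUpTo-single : ∀ f n b → b < n → f b ≡ 1 → (∀ i → i < n → i ≢ b → f i ≡ 0) → sumUpTo f n ≡ 1
sumUpTo-single f (suc n) zero    _         fb≡1 rest =
  cong₂ _+_ fb≡1 (sumUpTo-zero n (λ i i<n → rest (suc i) (s<s i<n) λ ()))
sumUpTo-single f (suc n) (suc b) (s<s b<n) fb≡1 rest =
  cong₂ _+_ (rest 0 z<s λ ()) (sumUpTo-single (f ∘ suc) n b b<n fb≡1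
    (λ i i<n i≢b → rest (suc i) (s<s i<n) (i≢b ∘ suc-injective)))

indicator : ∀ {ℓ} {A : Set ℓ} → Dec A → ℕ
indicator (yes _) = 1
indicator (no  _) = 0

indicator-cong : ∀ {ℓ ℓ′} {A : Set ℓ} {B : Set ℓ′} → A ⇔ B → (A? : Dec A) (B? : Dec B) →
                 indicator A? ≡ indicator B?
indicator-cong A⇔B (yes _) (yes _) = refl
indicator-cong A⇔B (yes a) (no ¬b) = contradiction (to A⇔B a) ¬b
indicator-cong A⇔B (no ¬a) (yes b) = contradiction (from A⇔B b) ¬a
indicator-cong A⇔B (no _)  (no _)  = refl

indicator-× : ∀ {ℓ ℓ′} {A : Set ℓ} {B : Set ℓ′} (A? : Dec A) (B? : Dec B) →
              indicator (A? ×-dec B?) ≡ indicator A? * indicator B?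
indicator-× (yes _) (yes _) = refl
indicator-× (yes _) (no _)  = refl
indicator-× (no _)  (yes _) = refl
indicator-× (no _)  (no _)  = refl

length-filter-applyUpTo : ∀ {ℓ} {A : ℕ → Set ℓ} (A? : ∀ x → Dec (A x)) f n →
                          length (filter A? (applyUpTo f n)) ≡ sumUpTo (λ i → indicator (A? (f i))) n
length-filter-applyUpTo A? f zero = refl
length-filter-applyUpTo A? f (suc n) with A? (f 0)
... | yes _ = cong suc (length-filter-applyUpTo A? (f ∘ suc) n)
... | no  _ = length-filter-applyUpTo A? (f ∘ suc) n

coprime-*ʳ⇔ : Coprime x (m * n) ⇔ (Coprime x m × Coprime x n)
coprime-*ʳ⇔ {x} {m} {n} = mk⇔
  (λ c → (λ {_} (d∣x , d∣m) → c (d∣x , ∣m⇒∣m*n n d∣m)) , (λ {_} (d∣x , d∣n) → c (d∣x , ∣n⇒∣m*n m d∣n)))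
  (λ (cm , cn) {d} (d∣x , d∣mn) → cn (d∣x , coprime-divisor (λ {_} (e∣d , e∣m) → cm (∣-trans e∣d d∣x , e∣m)) d∣mn))

coprime-*+ˡ⇔ : Coprime (b * m + a) m ⇔ Coprime a m
coprime-*+ˡ⇔ {b} {m} {a} = mk⇔
  (λ c {_} (d∣a , d∣m) → c (∣m∣n⇒∣m+n (∣n⇒∣m*n b d∣m) d∣a , d∣m))
  (λ c {_} (d∣x , d∣m) → c (∣m+n∣m⇒∣n d∣x (∣n⇒∣m*n b d∣m) , d∣m))

coprime-+ʳ⇔ : Coprime (a + m) m ⇔ Coprime a m
coprime-+ʳ⇔ {a} {m} = subst (λ z → Coprime z m ⇔ Coprime a m) a+m≡ (coprime-*+ˡ⇔ {1} {m} {a})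
  where
  a+m≡ : 1 * m + a ≡ a + m
  a+m≡ = trans (cong (_+ a) (*-identityˡ m)) (+-comm m a)

prime⇒coprime⇔∤ : ∀ {q} → Prime q → Coprime x q ⇔ (¬ q ∣ x)
prime⇒coprime⇔∤ pq@(prime _) = mk⇔
  (λ c q∣x → nonTrivial⇒≢1 (c (q∣x , ∣-refl)))
  (λ q∤x {_} (d∣x , d∣q) → case prime⇒irreducible pq d∣q of λ
     { (inj₁ d≡1)  → d≡1
     ; (inj₂ refl) → contradiction d∣x q∤x })

coprime-product : ∀ {ns} → All (Coprime x) ns → Coprime x (product ns)
coprime-product []         (_ , d∣1) = ∣1⇒≡1 d∣1
coprime-product (cx ∷ cxs)           = from coprime-*ʳ⇔ (cx , coprime-product cxs)

-- Roots of b ↦ b·P + c modulo q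

module Roots (q P : ℕ) .{{_ : NonZero q}} (q⊥P : Coprime q P) where

  ∣*+⇒∣%*+ : q ∣ b * P + c → q ∣ b % q * P + c
  ∣*+⇒∣%*+ {b} {c} q∣ = ∣m+n∣m⇒∣n (subst (q ∣_) split q∣) (∣n⇒∣m*n (b / q * P) ∣-refl)
    where
    split : b * P + c ≡ b / q * P * q + (b % q * P + c)
    split = begin
      b * P + c                        ≡⟨ cong (λ z → z * P + c) (m≡m%n+[m/n]*n b q) ⟩
      (b % q + b / q * q) * P + c      ≡⟨ solve 5 (λ r d q P c → (r :+ d :* q) :* P :+ c := d :* P :* q :+ (r :* P :+ c))
                                                refl (b % q) (b / q) q P c ⟩
      b / q * P * q + (b % q * P + c)  ∎
      where open ≡-Reasoning

  -- The two Bézout cases give P·y ≡ −1 resp. P·y ≡ 1 (mod q); in the second,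
  -- multiplying by q − 1 ≡ −1 gives the inverse of −P.
  ∃-neg-inverse : ∃[ y ] q ∣ y * P + 1
  ∃-neg-inverse with coprime-Bézout q⊥P
  ... | Bézout.+- x y eq = y , divides x (trans (+-comm (y * P) 1) eq)
  ... | Bézout.-+ x y eq = y * r , divides (1 + x * r) (begin
      y * r * P + 1          ≡⟨ solve 3 (λ y r P → y :* r :* P :+ con 1 := y :* P :* r :+ con 1) refl y r P ⟩
      y * P * r + 1          ≡⟨ cong (λ z → z * r + 1) (sym eq) ⟩
      (1 + x * q) * r + 1    ≡⟨ cong (λ z → (1 + x * z) * r + 1) q≡1+r ⟩
      (1 + x * suc r) * r + 1 ≡⟨ solve 2 (λ x r → (con 1 :+ x :* (con 1 :+ r)) :* r :+ con 1
                                        := (con 1 :+ x :* r) :* (con 1 :+ r)) refl x r ⟩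
      (1 + x * r) * suc r    ≡⟨ cong ((1 + x * r) *_) (sym q≡1+r) ⟩
      (1 + x * r) * q        ∎)
    where
    open ≡-Reasoning
    r : ℕ
    r = q ∸ 1
    q≡1+r : q ≡ suc r
    q≡1+r = sym (suc-pred q)

  ∃-root : ∀ c → ∃[ b ] b < q × q ∣ b * P + c
  ∃-root c with y , q∣yP+1 ← ∃-neg-inverse =
    (c * y) % q , m%n<n (c * y) q , ∣*+⇒∣%*+ (subst (q ∣_) eq (∣n⇒∣m*n c q∣yP+1))
    where
    eq : c * (y * P + 1) ≡ c * y * P + c
    eq = solve 3 (λ c y P → c :* (y :* P :+ con 1) := c :* y :* P :+ c) refl c y P

  root-unique : ∀ {b b′} c → b < b′ → b′ < q → q ∣ b * P + c → ¬ q ∣ b′ * P + c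
  root-unique {b} {b′} c b<b′ b′<q q∣bP+c q∣b′P+c = <⇒≱ d<q (∣⇒≤ {{d≢0}} q∣d)
    where
    d : ℕ
    d = b′ ∸ b
    d<q : d < q
    d<q = ≤-<-trans (m∸n≤m b′ b) b′<q
    d≢0 : NonZero d
    d≢0 = >-nonZero (m<n⇒0<n∸m b<b′)
    eq : b′ * P + c ≡ (b * P + c) + d * P
    eq = begin
      b′ * P + c            ≡⟨ cong (λ z → z * P + c) (sym (m∸n+n≡m (<⇒≤ b<b′))) ⟩
      (d + b) * P + c       ≡⟨ solve 4 (λ d b P c → (d :+ b) :* P :+ c := (b :* P :+ c) :+ d :* P) refl d b P c ⟩
      (b * P + c) + d * P   ∎
      where open ≡-Reasoning
    q∣d : q ∣ d
    q∣d = coprime-divisor q⊥P (subst (q ∣_) (*-comm d P) (∣m+n∣m⇒∣n (subst (q ∣_) eq q∣b′P+c) q∣bP+c))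

  count-roots : ∀ c → sumUpTo (λ b → indicator (q ∣? b * P + c)) q ≡ 1
  count-roots c with b₀ , b₀<q , q∣b₀P+c ← ∃-root c =
    sumUpTo-single _ q b₀ b₀<q (at-root (q ∣? b₀ * P + c)) off-root
    where
    at-root : (d : Dec (q ∣ b₀ * P + c)) → indicator d ≡ 1
    at-root (yes _)  = refl
    at-root (no q∤)  = contradiction q∣b₀P+c q∤
    off-root : ∀ b → b < q → b ≢ b₀ → indicator (q ∣? b * P + c) ≡ 0
    off-root b b<q b≢b₀ with q ∣? b * P + c
    ... | no  _     = refl
    ... | yes q∣bP+c with <-cmp b b₀
    ...   | tri< b<b₀ _ _ = contradiction q∣b₀P+c (root-unique c b<b₀ b₀<q q∣bP+c)
    ...   | tri≈ _ b≡b₀ _ = contradiction b≡b₀ b≢b₀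
    ...   | tri> _ _ b>b₀ = contradiction q∣bP+c (root-unique c b>b₀ b<q q∣b₀P+c)

  Avoids : ℕ → ℕ → Set
  Avoids k x = ¬ q ∣ x × ¬ q ∣ x + k

  avoids? : ∀ k x → Dec (Avoids k x)
  avoids? k x = ¬? (q ∣? x) ×-dec ¬? (q ∣? x + k)

  count-avoiding : ¬ q ∣ k → ∀ a → sumUpTo (λ b → indicator (avoids? k (b * P + a))) q ≡ q ∸ 2
  count-avoiding {k} q∤k a = begin
    S-avoid                         ≡⟨ m+n∸m≡n 2 S-avoid ⟨
    2 + S-avoid ∸ 2                 ≡⟨ cong (_∸ 2) partition ⟩
    q ∸ 2                           ∎
    where
    open ≡-Reasoning
    hit₁ hit₂ avoid : ℕ → ℕ
    hit₁ b  = indicator (q ∣? b * P + a)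
    hit₂ b  = indicator (q ∣? b * P + a + k)
    avoid b = indicator (avoids? k (b * P + a))
    S-avoid : ℕ
    S-avoid = sumUpTo avoid q

    exactly-one : ∀ b → avoid b + (hit₁ b + hit₂ b) ≡ 1
    exactly-one b with q ∣? b * P + a | q ∣? b * P + a + k
    ... | yes q∣x | yes q∣x+k = contradiction (∣m+n∣m⇒∣n q∣x+k q∣x) q∤k
    ... | yes _   | no  _     = refl
    ... | no  _   | yes _     = refl
    ... | no  _   | no  _     = refl

    hits₂ : sumUpTo hit₂ q ≡ 1
    hits₂ = trans (sumUpTo-cong q (λ b _ → cong (λ z → indicator (q ∣? z)) (+-assoc (b * P) a k)))
                  (count-roots (a + k))

    partition : 2 + S-avoid ≡ q
    partition = begin
      2 + S-avoid                                       ≡⟨ +-comm 2 S-avoid ⟩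
      S-avoid + (1 + 1)                                 ≡⟨ cong (S-avoid +_) (cong₂ _+_ (count-roots a) hits₂) ⟨
      S-avoid + (sumUpTo hit₁ q + sumUpTo hit₂ q)       ≡⟨ cong (S-avoid +_) (sumUpTo-distrib-+ hit₁ hit₂ q) ⟨
      S-avoid + sumUpTo (λ b → hit₁ b + hit₂ b) q       ≡⟨ sumUpTo-distrib-+ avoid _ q ⟨
      sumUpTo (λ b → avoid b + (hit₁ b + hit₂ b)) q     ≡⟨ sumUpTo-cong q (λ b _ → exactly-one b) ⟩
      sumUpTo (λ _ → 1) q                               ≡⟨ sumUpTo-const 1 q ⟩
      q * 1                                             ≡⟨ *-identityʳ q ⟩
      q                                                 ∎

-- Pairs t, t + k coprime to a modulus

TwinCoprime : ℕ → ℕ → ℕ → Set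
TwinCoprime k M t = Coprime t M × Coprime (t + k) M

twinCoprime? : ∀ k M t → Dec (TwinCoprime k M t)
twinCoprime? k M t = coprime? t M ×-dec coprime? (t + k) M

twinCount : ℕ → ℕ → ℕ
twinCount k M = sumUpTo (λ t → indicator (twinCoprime? k M t)) M

twinCoprime-periodic : ∀ {N} → TwinCoprime k N (t + N) ⇔ TwinCoprime k N t
twinCoprime-periodic {k} {t} {N} = mk⇔
  (λ (c , c′) → to coprime-+ʳ⇔ c , to coprime-+ʳ⇔ (subst (λ z → Coprime z N) shuffle c′))
  (λ (c , c′) → from coprime-+ʳ⇔ c , subst (λ z → Coprime z N) (sym shuffle) (from coprime-+ʳ⇔ c′))
  where
  shuffle : t + N + k ≡ t + k + N
  shuffle = xy∙z≈xz∙y t N k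

twinCount-window : ∀ k N c → sumUpTo (λ i → indicator (twinCoprime? k N (c + i))) N ≡ twinCount k N
twinCount-window k N = sumUpTo-periodic (indicator ∘ twinCoprime? k N) N
  (λ x → indicator-cong twinCoprime-periodic (twinCoprime? k N (x + N)) (twinCoprime? k N x))

module _ (q P : ℕ) (q-prime : Prime q) (q⊥P : Coprime q P) where
  private instance
    q≢0 : NonZero q
    q≢0 = prime⇒nonZero q-prime
  open Roots q P q⊥P

  coprime-*+-split : Coprime (b * P + a) (q * P) ⇔ (¬ q ∣ b * P + a × Coprime a P)
  coprime-*+-split {b} = ⇔-trans coprime-*ʳ⇔ (prime⇒coprime⇔∤ q-prime ×-⇔ coprime-*+ˡ⇔ {b})

  twinCoprime-split : TwinCoprime k (q * P) (b * P + a) ⇔ (TwinCoprime k P a × Avoids k (b * P + a))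
  twinCoprime-split {k} {b} {a} = mk⇔
    (λ (c , c′) → let (q∤ , ca) = to split c ; (q∤′ , ca′) = to split′ (subst C assoc c′)
                  in (ca , ca′) , (q∤ , subst (λ z → ¬ q ∣ z) (sym assoc) q∤′))
    (λ ((ca , ca′) , (q∤ , q∤′)) → from split (q∤ , ca)
                                 , subst C (sym assoc) (from split′ (subst (λ z → ¬ q ∣ z) assoc q∤′ , ca′)))
    where
    split : Coprime (b * P + a) (q * P) ⇔ (¬ q ∣ b * P + a × Coprime a P)
    split = coprime-*+-split {b}
    split′ : Coprime (b * P + (a + k)) (q * P) ⇔ (¬ q ∣ b * P + (a + k) × Coprime (a + k) P)
    split′ = coprime-*+-split {b}
    C : ℕ → Set
    C z = Coprime z (q * P)
    assoc : b * P + a + k ≡ b * P + (a + k)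
    assoc = +-assoc (b * P) a k

  twinCount-* : ¬ q ∣ k → twinCount k (q * P) ≡ (q ∸ 2) * twinCount k P
  twinCount-* {k} q∤k = begin
    twinCount k (q * P)
      ≡⟨ sumUpTo-blocks (indicator ∘ twinCoprime? k (q * P)) P q ⟩
    sumUpTo (λ b → sumUpTo (λ a → indicator (twinCoprime? k (q * P) (b * P + a))) P) q
      ≡⟨ sumUpTo-comm (λ b a → indicator (twinCoprime? k (q * P) (b * P + a))) q P ⟩
    sumUpTo (λ a → sumUpTo (λ b → indicator (twinCoprime? k (q * P) (b * P + a))) q) P
      ≡⟨ sumUpTo-cong P (λ a _ → sumUpTo-cong q (λ b _ → factor a b)) ⟩
    sumUpTo (λ a → sumUpTo (λ b → twin a * indicator (avoids? k (b * P + a))) q) P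
      ≡⟨ sumUpTo-cong P (λ a _ → trans (sumUpTo-*ˡ (twin a) _ q) (cong (twin a *_) (count-avoiding q∤k a))) ⟩
    sumUpTo (λ a → twin a * (q ∸ 2)) P
      ≡⟨ sumUpTo-cong P (λ a _ → *-comm (twin a) (q ∸ 2)) ⟩
    sumUpTo (λ a → (q ∸ 2) * twin a) P
      ≡⟨ sumUpTo-*ˡ (q ∸ 2) twin P ⟩
    (q ∸ 2) * twinCount k P ∎
    where
    open ≡-Reasoning
    twin : ℕ → ℕ
    twin a = indicator (twinCoprime? k P a)
    factor : ∀ a b → indicator (twinCoprime? k (q * P) (b * P + a)) ≡ twin a * indicator (avoids? k (b * P + a))
    factor a b = trans (indicator-cong (twinCoprime-split {k} {b} {a}) _ (twinCoprime? k P a ×-dec avoids? k (b * P + a)))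
                       (indicator-× (twinCoprime? k P a) (avoids? k (b * P + a)))

headOr0-All : ∀ {ℓ} {A : ℕ → Set ℓ} {xs} → All A xs → x ∈ xs → A (headOr0 xs)
headOr0-All (ax ∷ _) _ = ax

∃-prime-divisor : ∀ n → 2 ≤ n → ∃[ q ] Prime q × q ∣ n
∃-prime-divisor n@(suc _) 2≤n with factorise n
... | record { factors = [] ; isFactorisation = n≡1 } = contradiction (subst (2 ≤_) n≡1 2≤n) λ { (s≤s ()) }
... | record { factors = q ∷ _ ; isFactorisation = n≡∏ ; factorsPrime = q-prime ∷ _ } =
  q , q-prime , subst (q ∣_) (sym n≡∏) (m∣m*n _)

-- Euclid: a prime factor of x! + 1 exceeds x.
∃-prime-in-window : ∀ x → ∃[ q ] Prime q × x < q × q ≤ x ! + 1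
∃-prime-in-window x with q , q-prime , q∣x!+1 ← ∃-prime-divisor (x ! + 1) (+-monoˡ-≤ 1 (1≤n! x)) =
  q , q-prime , x<q , ∣⇒≤ {{x!+1≢0}} q∣x!+1
  where
  x!+1≢0 : NonZero (x ! + 1)
  x!+1≢0 = subst NonZero (+-comm 1 (x !)) _
  x<q : x < q
  x<q with x <? q
  ... | yes x<q = x<q
  ... | no  x≮q = contradiction (∣1⇒≡1 (∣m+n∣m⇒∣n q∣x!+1 (q∣x! q-prime (≮⇒≥ x≮q))))
                                (nonTrivial⇒≢1 {{prime⇒nonTrivial q-prime}})
    where
    q∣x! : ∀ {q} → Prime q → q ≤ x → q ∣ x !
    q∣x! {suc q} _ q≤x = ∣-trans (m∣m*n (q !)) (m≤n⇒m!∣n! q≤x)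

nextPrime-spec : ∀ x → Prime (nextPrime x) × x < nextPrime x
nextPrime-spec x with q , q-prime , x<q , q≤ ← ∃-prime-in-window x =
  headOr0-All (All.all-filter prime? candidates) q∈
  , headOr0-All (All.filter⁺ prime? (All.applyUpTo⁺₂ {P = x <_} (suc x +_) (x ! + 1 ∸ x) (λ i → s≤s (m≤m+n x i)))) q∈
  where
  candidates : List ℕ
  candidates = range (suc x) (x ! + 1)
  q∈ : q ∈ filter prime? candidates
  q∈ = ∈-filter⁺ prime? (subst (_∈ candidates) (m+[n∸m]≡n x<q)
         (∈-applyUpTo⁺ (suc x +_) (∸-monoˡ-< (s≤s q≤) x<q))) q-prime

p-prime : ∀ i → Prime (p (suc i))
p-prime zero    = prime[2]
p-prime (suc i) = proj₁ (nextPrime-spec (p (suc i)))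

p-strictlyIncreasing : ∀ {i j} → i < j → p (suc i) < p (suc j)
p-strictlyIncreasing {i} {suc j} (s≤s i≤j) with m≤n⇒m<n∨m≡n i≤j
... | inj₁ i<j  = <-trans (p-strictlyIncreasing i<j) (proj₂ (nextPrime-spec (p (suc j))))
... | inj₂ refl = proj₂ (nextPrime-spec (p (suc i)))

primorial-suc : ∀ m → primorial (suc m) ≡ p (suc m) * primorial m
primorial-suc m = begin
  product (map p (applyUpTo suc (suc m)))              ≡⟨ cong (product ∘ map p) (applyUpTo-∷ʳ suc m) ⟨
  product (map p (applyUpTo suc m ∷ʳ suc m))           ≡⟨ cong product (map-++ p (applyUpTo suc m) [ suc m ]) ⟩
  product (map p (applyUpTo suc m) ++ [ p (suc m) ])   ≡⟨ product-++ (map p (applyUpTo suc m)) [ p (suc m) ] ⟩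
  primorial m * (p (suc m) * 1)                        ≡⟨ cong (primorial m *_) (*-identityʳ (p (suc m))) ⟩
  primorial m * p (suc m)                              ≡⟨ *-comm (primorial m) (p (suc m)) ⟩
  p (suc m) * primorial m                              ∎
  where
  open ≡-Reasoning

p⊥primorial : ∀ m → Coprime (p (suc m)) (primorial m)
p⊥primorial m = coprime-product (All.map⁺ (All.applyUpTo⁺₁ suc m λ {i} i<m →
  prime⇒coprime (p-prime m) {{prime⇒nonZero (p-prime i)}} (p-strictlyIncreasing i<m)))

210∣primorial : ∀ k → 210 ∣ primorial (4 + k)
210∣primorial zero    = ∣-refl
210∣primorial (suc k) = subst (210 ∣_) (sym (primorial-suc (4 + k))) (∣n⇒∣m*n (p (5 + k)) (210∣primorial k))

¬coprime-common : ∀ {N} d → .{{NonTrivial d}} → d ∣ N → d ∣ x → ¬ Coprime (N + x) N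
¬coprime-common d d∣N d∣x c = nonTrivial⇒≢1 (c (∣m∣n⇒∣m+n d∣N d∣x , d∣N))

210∣⇒¬coprime-+ : ∀ {N} → 210 ∣ N → 2 ≤ x → x ≤ 7 → ¬ Coprime (N + x) N
210∣⇒¬coprime-+ {x = 2} 210∣N _ _ = ¬coprime-common 2 (∣-trans (divides 105 refl) 210∣N) ∣-refl
210∣⇒¬coprime-+ {x = 3} 210∣N _ _ = ¬coprime-common 3 (∣-trans (divides 70 refl) 210∣N) ∣-refl
210∣⇒¬coprime-+ {x = 4} 210∣N _ _ = ¬coprime-common 2 (∣-trans (divides 105 refl) 210∣N) (divides 2 refl)
210∣⇒¬coprime-+ {x = 5} 210∣N _ _ = ¬coprime-common 5 (∣-trans (divides 42 refl) 210∣N) ∣-refl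
210∣⇒¬coprime-+ {x = 6} 210∣N _ _ = ¬coprime-common 2 (∣-trans (divides 105 refl) 210∣N) (divides 3 refl)
210∣⇒¬coprime-+ {x = 7} 210∣N _ _ = ¬coprime-common 7 (∣-trans (divides 30 refl) 210∣N) ∣-refl
210∣⇒¬coprime-+ {x = 0} _ () _
210∣⇒¬coprime-+ {x = 1} _ (s≤s ()) _
210∣⇒¬coprime-+ {x = suc (suc (suc (suc (suc (suc (suc (suc _)))))))} _ _ (s≤s (s≤s (s≤s (s≤s (s≤s (s≤s (s≤s ())))))))

coprime⇒in-window : ∀ {N} → 210 ∣ N → t ≤ N + 1 → Coprime (t + 6) N → t + 6 ≤ N + 1
coprime⇒in-window {t} {N} 210∣N t≤N+1 c with t + 6 ≤? N + 1
... | yes in-window = in-window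
... | no  beyond    = ⊥-elim (210∣⇒¬coprime-+ 210∣N 2≤r r≤7 (subst (λ z → Coprime z N) (sym N+r≡t+6) c))
  where
  N+2≤t+6 : N + 2 ≤ t + 6
  N+2≤t+6 = subst (_≤ t + 6) (sym (+-suc N 1)) (≰⇒> beyond)
  r : ℕ
  r = t + 6 ∸ N
  N+r≡t+6 : N + r ≡ t + 6
  N+r≡t+6 = m+[n∸m]≡n (≤-trans (m≤m+n N 2) N+2≤t+6)
  2≤r : 2 ≤ r
  2≤r = +-cancelˡ-≤ N 2 r (subst (N + 2 ≤_) (sym N+r≡t+6) N+2≤t+6)
  r≤7 : r ≤ 7
  r≤7 = +-cancelˡ-≤ N r 7 (subst (_≤ N + 7) (sym N+r≡t+6) (subst (t + 6 ≤_) (+-assoc N 1 6) (+-monoˡ-≤ 6 t≤N+1)))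

sexy≡twinCount : ∀ n → 210 ∣ primorial n → sexy n ≡ twinCount 6 (primorial n)
sexy≡twinCount n 210∣N = begin
  sexy n
    ≡⟨ length-filter-applyUpTo (λ t → totative? n t ×-dec totative? n (t + 6)) (2 +_) (suc (N + 1) ∸ 2) ⟩
  sumUpTo (λ i → indicator (totative? n (2 + i) ×-dec totative? n (2 + i + 6))) (N + 1 ∸ 1)
    ≡⟨ cong (sumUpTo _) (m+n∸n≡m N 1) ⟩
  sumUpTo (λ i → indicator (totative? n (2 + i) ×-dec totative? n (2 + i + 6))) N
    ≡⟨ sumUpTo-cong N (λ i i<N → indicator-cong (totatives⇔twinCoprime i<N) _ _) ⟩
  sumUpTo (λ i → indicator (twinCoprime? 6 N (2 + i))) N
    ≡⟨ twinCount-window 6 N 2 ⟩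
  twinCount 6 N ∎
  where
  open ≡-Reasoning
  N : ℕ
  N = primorial n
  totatives⇔twinCoprime : ∀ {i} → i < N → (Totative n (2 + i) × Totative n (2 + i + 6)) ⇔ TwinCoprime 6 N (2 + i)
  totatives⇔twinCoprime {i} i<N = mk⇔
    (λ ((_ , c) , (_ , c′)) → c , c′)
    (λ (c , c′) → ((s≤s (s≤s z≤n) , t≤N+1) , c)
                , ((s≤s (s≤s z≤n) , coprime⇒in-window 210∣N t≤N+1 c′) , c′))
    where
    t≤N+1 : 2 + i ≤ N + 1
    t≤N+1 = subst (2 + i ≤_) (+-comm 1 N) (s≤s i<N)

sexy-suc : ∀ m → 4 ≤ m → sexy (suc m) ≡ (p (suc m) ∸ 2) * sexy m
sexy-suc 0 ()
sexy-suc 1 (s≤s ())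
sexy-suc 2 (s≤s (s≤s ()))
sexy-suc 3 (s≤s (s≤s (s≤s ())))
sexy-suc m@(suc (suc (suc (suc k)))) _ = begin
  sexy (suc m)                              ≡⟨ sexy≡twinCount (suc m) (210∣primorial (suc k)) ⟩
  twinCount 6 (primorial (suc m))           ≡⟨ cong (twinCount 6) (primorial-suc m) ⟩
  twinCount 6 (q * primorial m)             ≡⟨ twinCount-* q (primorial m) (p-prime m) (p⊥primorial m) q∤6 ⟩
  (q ∸ 2) * twinCount 6 (primorial m)       ≡⟨ cong ((q ∸ 2) *_) (sexy≡twinCount m (210∣primorial k)) ⟨
  (q ∸ 2) * sexy m                          ∎
  where
  open ≡-Reasoning
  q : ℕ
  q = p (suc m)
  q∤6 : ¬ q ∣ 6
  q∤6 q∣6 = <⇒≱ (p-strictlyIncreasing {3} {m} (s≤s (s≤s (s≤s (s≤s z≤n))))) (≤-trans (∣⇒≤ q∣6) (n≤1+n 6))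

corollary6 : (sexy 1 ≡ 0) × (sexy 2 ≡ 0) × (sexy 3 ≡ 5) × (sexy 4 ≡ 30)
    × (∀ (n : ℕ) → 4 < n → sexy n ≡ (p n ∸ 2) * sexy (n ∸ 1))
corollary6 = refl , refl , refl , refl , λ { (suc m) (s≤s 4≤m) → sexy-suc m 4≤m }
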